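{- If the sequent $\Gamma^{K^+}, \neg \Delta^{K^- } \vdash D^{K^- }$ is provable in the intuitionistic sequent calculus, then $\Gamma \vdash \Delta, D$ is provable in the classical sequent calculus.
   Context: First-order logic with connectives $\wedge,\vee,\Rightarrow,\neg$ and quantifiers $\forall,\exists$. The classical sequent calculus is the usual cut-free multi-conclusion sequent calculus (sequents $\Gamma\vdash\Delta$ of multisets, axiom $\Gamma,A\vdash A,\Delta$, left/right rules for each connective and quantifier, contraction and weakening on both sides, no cut). The intuitionistic sequent calculus is its cut-free restriction where the right-hand side contains at most one formula (no right contraction, $\Delta$ empty in the axiom and in the first premiss of $\Rightarrow_L$, and $\vee_R$ split into two rules choosing a disjunct). The polarized Kolmogorov translations are defined by induction: for $A$ atomic, $A^{K^+}\equiv A$ and $A^{K^- }\equiv A$; $(A\wedge B)^{K^+}\equiv A^{K^+}\wedge B^{K^+}$, $(A\wedge B)^{K^- }\equiv \neg\neg A^{K^- }\wedge\neg\neg B^{K^- }$; $(A\vee B)^{K^+}\equiv A^{K^+}\vee B^{K^+}$, $(A\vee B)^{K^- }\equiv \neg\neg A^{K^- }\vee\neg\neg B^{K^- }$; $(A\Rightarrow B)^{K^+}\equiv \neg\neg A^{K^- }\Rightarrow B^{K^+}$, $(A\Rightarrow B)^{K^- }\equiv A^{K^+}\Rightarrow\neg\neg B^{K^- }$; $(\neg A)^{K^+}\equiv\neg A^{K^- }$, $(\neg A)^{K^- }\equiv\neg A^{K^+}$; $(\forall x A)^{K^+}\equiv\forall x A^{K^+}$, $(\forall x A)^{K^- }\equiv\forall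 x\neg\neg A^{K^- }$; $(\exists x A)^{K^+}\equiv\exists x A^{K^+}$, $(\exists x A)^{K^- }\equiv\exists x\neg\neg A^{K^- }$. Translations and negations of multisets are applied formula by formula. $D$ is a formula. -}

module Defs where

open import Data.Nat using (ℕ; zero; suc)
open import Data.Vec using (Vec; []; _∷_)
open import Data.List using (List; []; _∷_; map)
open import Data.Maybe using (Maybe; just; nothing)
open import Data.List.Relation.Binary.Permutation.Propositional using (_↭_)

record Signature : Set₁ where
  field
    Fun      : Set
    funArity : Fun → ℕ
    Pred     : Set
    predArity : Pred → ℕ

module FOL (S : Signature) where
  open Signature S

  -- Terms; variables are de Bruijn indices (an infinite supply of variables).
  data Term : Set where
    var : ℕ → Term
    fun : (f : Fun) → Vec Term (funArity f) → Term

  infixr 6 _∧_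
  infixr 5 _∨_
  infixr 4 _⇒_

  data Formula : Set where
    atom : (P : Pred) → Vec Term (predArity P) → Formula
    _∧_ _∨_ _⇒_ : Formula → Formula → Formula
    ¬_ : Formula → Formula
    ∀′ ∃′ : Formula → Formula

  mutual
    renT : (ℕ → ℕ) → Term → Term
    renT ρ (var i) = var (ρ i)
    renT ρ (fun f ts) = fun f (renV ρ ts)

    renV : ∀ {k} → (ℕ → ℕ) → Vec Term k → Vec Term k
    renV ρ [] = []
    renV ρ (t ∷ ts) = renT ρ t ∷ renV ρ ts

  mutual
    subT : (ℕ → Term) → Term → Term
    subT σ (var i) = σ i
    subT σ (fun f ts) = fun f (subV σ ts)

    subV : ∀ {k} → (ℕ → Term) → Vec Term k → Vec Term k
    subV σ [] = []
    subV σ (t ∷ ts) = subT σ t ∷ subV σ ts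

  liftR : (ℕ → ℕ) → ℕ → ℕ
  liftR ρ zero = zero
  liftR ρ (suc i) = suc (ρ i)

  liftS : (ℕ → Term) → ℕ → Term
  liftS σ zero = var zero
  liftS σ (suc i) = renT suc (σ i)

  renF : (ℕ → ℕ) → Formula → Formula
  renF ρ (atom P ts) = atom P (renV ρ ts)
  renF ρ (A ∧ B) = renF ρ A ∧ renF ρ B
  renF ρ (A ∨ B) = renF ρ A ∨ renF ρ B
  renF ρ (A ⇒ B) = renF ρ A ⇒ renF ρ B
  renF ρ (¬ A) = ¬ renF ρ A
  renF ρ (∀′ A) = ∀′ (renF (liftR ρ) A)
  renF ρ (∃′ A) = ∃′ (renF (liftR ρ) A)

  subF : (ℕ → Term) → Formula → Formula
  subF σ (atom P ts) = atom P (subV σ ts)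
  subF σ (A ∧ B) = subF σ A ∧ subF σ B
  subF σ (A ∨ B) = subF σ A ∨ subF σ B
  subF σ (A ⇒ B) = subF σ A ⇒ subF σ B
  subF σ (¬ A) = ¬ subF σ A
  subF σ (∀′ A) = ∀′ (subF (liftS σ) A)
  subF σ (∃′ A) = ∃′ (subF (liftS σ) A)

  -- weakening: shift all free variables up by one (makes index 0 fresh)
  wk : Formula → Formula
  wk = renF suc

  single : Term → ℕ → Term
  single t zero = t
  single t (suc i) = var i

  _[_] : Formula → Term → Formula
  A [ t ] = subF (single t) A

  infix 3 _⊢ᶜ_ _⊢ⁱ_

  -- Classical cut-free sequent calculus LK (multisets = lists up to permutation).
  data _⊢ᶜ_ : List Formula → List Formula → Set where
    ax    : ∀ {Γ Δ A} → A ∷ Γ ⊢ᶜ A ∷ Δ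
    ∧L    : ∀ {Γ Δ A B} → A ∷ B ∷ Γ ⊢ᶜ Δ → (A ∧ B) ∷ Γ ⊢ᶜ Δ
    ∧R    : ∀ {Γ Δ A B} → Γ ⊢ᶜ A ∷ Δ → Γ ⊢ᶜ B ∷ Δ → Γ ⊢ᶜ (A ∧ B) ∷ Δ
    ∨L    : ∀ {Γ Δ A B} → A ∷ Γ ⊢ᶜ Δ → B ∷ Γ ⊢ᶜ Δ → (A ∨ B) ∷ Γ ⊢ᶜ Δ
    ∨R    : ∀ {Γ Δ A B} → Γ ⊢ᶜ A ∷ B ∷ Δ → Γ ⊢ᶜ (A ∨ B) ∷ Δ
    ⇒L    : ∀ {Γ Δ A B} → Γ ⊢ᶜ A ∷ Δ → B ∷ Γ ⊢ᶜ Δ → (A ⇒ B) ∷ Γ ⊢ᶜ Δ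
    ⇒R    : ∀ {Γ Δ A B} → A ∷ Γ ⊢ᶜ B ∷ Δ → Γ ⊢ᶜ (A ⇒ B) ∷ Δ
    ¬L    : ∀ {Γ Δ A} → Γ ⊢ᶜ A ∷ Δ → (¬ A) ∷ Γ ⊢ᶜ Δ
    ¬R    : ∀ {Γ Δ A} → A ∷ Γ ⊢ᶜ Δ → Γ ⊢ᶜ (¬ A) ∷ Δ
    ∀L    : ∀ {Γ Δ A} (t : Term) → (A [ t ]) ∷ Γ ⊢ᶜ Δ → ∀′ A ∷ Γ ⊢ᶜ Δ
    ∀R    : ∀ {Γ Δ A} → map wk Γ ⊢ᶜ A ∷ map wk Δ → Γ ⊢ᶜ ∀′ A ∷ Δ
    ∃L    : ∀ {Γ Δ A} → A ∷ map wk Γ ⊢ᶜ map wk Δ → ∃′ A ∷ Γ ⊢ᶜ Δ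
    ∃R    : ∀ {Γ Δ A} (t : Term) → Γ ⊢ᶜ (A [ t ]) ∷ Δ → Γ ⊢ᶜ ∃′ A ∷ Δ
    contrL : ∀ {Γ Δ A} → A ∷ A ∷ Γ ⊢ᶜ Δ → A ∷ Γ ⊢ᶜ Δ
    contrR : ∀ {Γ Δ A} → Γ ⊢ᶜ A ∷ A ∷ Δ → Γ ⊢ᶜ A ∷ Δ
    weakL : ∀ {Γ Δ A} → Γ ⊢ᶜ Δ → A ∷ Γ ⊢ᶜ Δ
    weakR : ∀ {Γ Δ A} → Γ ⊢ᶜ Δ → Γ ⊢ᶜ A ∷ Δ
    exch  : ∀ {Γ Γ′ Δ Δ′} → Γ ↭ Γ′ → Δ ↭ Δ′ → Γ ⊢ᶜ Δ → Γ′ ⊢ᶜ Δ′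

  -- Intuitionistic cut-free sequent calculus LJ: at most one formula on the right.
  data _⊢ⁱ_ : List Formula → Maybe Formula → Set where
    ax    : ∀ {Γ A} → A ∷ Γ ⊢ⁱ just A
    ∧L    : ∀ {Γ C A B} → A ∷ B ∷ Γ ⊢ⁱ C → (A ∧ B) ∷ Γ ⊢ⁱ C
    ∧R    : ∀ {Γ A B} → Γ ⊢ⁱ just A → Γ ⊢ⁱ just B → Γ ⊢ⁱ just (A ∧ B)
    ∨L    : ∀ {Γ C A B} → A ∷ Γ ⊢ⁱ C → B ∷ Γ ⊢ⁱ C → (A ∨ B) ∷ Γ ⊢ⁱ C
    ∨R₁   : ∀ {Γ A B} → Γ ⊢ⁱ just A → Γ ⊢ⁱ just (A ∨ B)
    ∨R₂   : ∀ {Γ A B} → Γ ⊢ⁱ just B → Γ ⊢ⁱ just (A ∨ B)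
    ⇒L    : ∀ {Γ C A B} → Γ ⊢ⁱ just A → B ∷ Γ ⊢ⁱ C → (A ⇒ B) ∷ Γ ⊢ⁱ C
    ⇒R    : ∀ {Γ A B} → A ∷ Γ ⊢ⁱ just B → Γ ⊢ⁱ just (A ⇒ B)
    ¬L    : ∀ {Γ A} → Γ ⊢ⁱ just A → (¬ A) ∷ Γ ⊢ⁱ nothing
    ¬R    : ∀ {Γ A} → A ∷ Γ ⊢ⁱ nothing → Γ ⊢ⁱ just (¬ A)
    ∀L    : ∀ {Γ C A} (t : Term) → (A [ t ]) ∷ Γ ⊢ⁱ C → ∀′ A ∷ Γ ⊢ⁱ C
    ∀R    : ∀ {Γ A} → map wk Γ ⊢ⁱ just A → Γ ⊢ⁱ just (∀′ A)
    ∃L    : ∀ {Γ A} {C : Maybe Formula} →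
            A ∷ map wk Γ ⊢ⁱ Data.Maybe.map wk C → ∃′ A ∷ Γ ⊢ⁱ C
    ∃R    : ∀ {Γ A} (t : Term) → Γ ⊢ⁱ just (A [ t ]) → Γ ⊢ⁱ just (∃′ A)
    contrL : ∀ {Γ C A} → A ∷ A ∷ Γ ⊢ⁱ C → A ∷ Γ ⊢ⁱ C
    weakL : ∀ {Γ C A} → Γ ⊢ⁱ C → A ∷ Γ ⊢ⁱ C
    weakR : ∀ {Γ A} → Γ ⊢ⁱ nothing → Γ ⊢ⁱ just A
    exch  : ∀ {Γ Γ′ C} → Γ ↭ Γ′ → Γ ⊢ⁱ C → Γ′ ⊢ⁱ C

  ¬¬_ : Formula → Formula
  ¬¬ A = ¬ (¬ A)

  mutual
    K⁺ : Formula → Formula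
    K⁺ (atom P ts) = atom P ts
    K⁺ (A ∧ B) = K⁺ A ∧ K⁺ B
    K⁺ (A ∨ B) = K⁺ A ∨ K⁺ B
    K⁺ (A ⇒ B) = ¬¬ K⁻ A ⇒ K⁺ B
    K⁺ (¬ A) = ¬ K⁻ A
    K⁺ (∀′ A) = ∀′ (K⁺ A)
    K⁺ (∃′ A) = ∃′ (K⁺ A)

    K⁻ : Formula → Formula
    K⁻ (atom P ts) = atom P ts
    K⁻ (A ∧ B) = ¬¬ K⁻ A ∧ ¬¬ K⁻ B
    K⁻ (A ∨ B) = ¬¬ K⁻ A ∨ ¬¬ K⁻ B
    K⁻ (A ⇒ B) = K⁺ A ⇒ ¬¬ K⁻ B
    K⁻ (¬ A) = ¬ K⁺ A
    K⁻ (∀′ A) = ∀′ (¬¬ K⁻ A)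
    K⁻ (∃′ A) = ∃′ (¬¬ K⁻ A)

module Submission where

-- Both translations only insert double negations (and negations already
-- present), so we introduce the relation  F ⇝ A  "erasing some ¬¬ from F
-- gives A" and show that K⁺ A ⇝ A and K⁻ A ⇝ A.  Classically ¬¬ is
-- invisible: two formulas read off the same F are interderivable, and if
-- ¬G ⇝ A and G ⇝ B then A and B are contradictory and exhaustive.
--
-- A hypothesis F is
-- read either as a left formula A (F ⇝ A) or, when F is ¬G, as a right
-- formula B (G ⇝ B); the conclusion is read likewise.  Induction on the LJ
-- derivation, which is invariant under permutations of the decoded context,
-- produces the decoded LK sequent.  The theorem is the instance where every
-- K⁺ A is read on the left, every ¬ K⁻ A on the right, and K⁻ D on the right.

open import Defs
open import Data.List using (List; map; _++_; [_]; []; _∷_)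
open import Data.List.Properties using (map-++; ++-identityʳ)
open import Data.List.Relation.Binary.Permutation.Propositional as ↭
  using (_↭_; ↭-sym; ↭-reflexive)
open import Data.List.Relation.Binary.Permutation.Propositional.Properties
  using (++-comm; ++⁺ʳ)
open import Data.Maybe using (Maybe; just; nothing)
import Data.Maybe as Maybe
open import Data.Nat using (ℕ; zero; suc)
open import Data.Vec using (Vec; []; _∷_)
open import Relation.Binary.PropositionalEquality
  using (_≡_; refl; cong; cong₂; subst; sym)

module Kolmogorov (S : Signature) where
  open FOL S

  -- Substituting after renaming is the identity when σ undoes ρ.
  -- Needed to instantiate a weakened quantifier body by the fresh variable.
  SubstInverts : (ℕ → Term) → (ℕ → ℕ) → Set
  SubstInverts σ ρ = ∀ i → σ (ρ i) ≡ var i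

  lift-inverts : ∀ {σ ρ} → SubstInverts σ ρ → SubstInverts (liftS σ) (liftR ρ)
  lift-inverts inv zero    = refl
  lift-inverts inv (suc i) = cong (renT suc) (inv i)

  mutual
    sub-renT : ∀ {σ ρ} → SubstInverts σ ρ → ∀ t → subT σ (renT ρ t) ≡ t
    sub-renT inv (var i)    = inv i
    sub-renT inv (fun f ts) = cong (fun f) (sub-renV inv ts)

    sub-renV : ∀ {σ ρ k} → SubstInverts σ ρ → (ts : Vec Term k) →
               subV σ (renV ρ ts) ≡ ts
    sub-renV inv []       = refl
    sub-renV inv (t ∷ ts) = cong₂ _∷_ (sub-renT inv t) (sub-renV inv ts)

  sub-renF : ∀ {σ ρ} → SubstInverts σ ρ → ∀ A → subF σ (renF ρ A) ≡ A
  sub-renF inv (atom P ts) = cong (atom P) (sub-renV inv ts)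
  sub-renF inv (A ∧ B) = cong₂ _∧_ (sub-renF inv A) (sub-renF inv B)
  sub-renF inv (A ∨ B) = cong₂ _∨_ (sub-renF inv A) (sub-renF inv B)
  sub-renF inv (A ⇒ B) = cong₂ _⇒_ (sub-renF inv A) (sub-renF inv B)
  sub-renF inv (¬ A)   = cong ¬_ (sub-renF inv A)
  sub-renF inv (∀′ A)  = cong ∀′ (sub-renF (lift-inverts inv) A)
  sub-renF inv (∃′ A)  = cong ∃′ (sub-renF (lift-inverts inv) A)

  wk-body-at-0 : ∀ A → subF (single (var zero)) (renF (liftR suc) A) ≡ A
  wk-body-at-0 = sub-renF single-inverts
    where
    single-inverts : SubstInverts (single (var zero)) (liftR suc)
    single-inverts zero    = refl
    single-inverts (suc i) = refl

  infix 3 _⇝_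

  data _⇝_ : Formula → Formula → Set where
    atom : ∀ {P ts} → atom P ts ⇝ atom P ts
    conj : ∀ {F G A B} → F ⇝ A → G ⇝ B → F ∧ G ⇝ A ∧ B
    disj : ∀ {F G A B} → F ⇝ A → G ⇝ B → F ∨ G ⇝ A ∨ B
    impl : ∀ {F G A B} → F ⇝ A → G ⇝ B → F ⇒ G ⇝ A ⇒ B
    neg  : ∀ {F A} → F ⇝ A → ¬ F ⇝ ¬ A
    all  : ∀ {F A} → F ⇝ A → ∀′ F ⇝ ∀′ A
    ex   : ∀ {F A} → F ⇝ A → ∃′ F ⇝ ∃′ A
    erase : ∀ {F A} → F ⇝ A → ¬¬ F ⇝ A

  mutual
    K⁺-erases : ∀ A → K⁺ A ⇝ A
    K⁺-erases (atom P ts) = atom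
    K⁺-erases (A ∧ B) = conj (K⁺-erases A) (K⁺-erases B)
    K⁺-erases (A ∨ B) = disj (K⁺-erases A) (K⁺-erases B)
    K⁺-erases (A ⇒ B) = impl (erase (K⁻-erases A)) (K⁺-erases B)
    K⁺-erases (¬ A)   = neg (K⁻-erases A)
    K⁺-erases (∀′ A)  = all (K⁺-erases A)
    K⁺-erases (∃′ A)  = ex (K⁺-erases A)

    K⁻-erases : ∀ A → K⁻ A ⇝ A
    K⁻-erases (atom P ts) = atom
    K⁻-erases (A ∧ B) = conj (erase (K⁻-erases A)) (erase (K⁻-erases B))
    K⁻-erases (A ∨ B) = disj (erase (K⁻-erases A)) (erase (K⁻-erases B))
    K⁻-erases (A ⇒ B) = impl (K⁺-erases A) (erase (K⁻-erases B))
    K⁻-erases (¬ A)   = neg (K⁺-erases A)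
    K⁻-erases (∀′ A)  = all (erase (K⁻-erases A))
    K⁻-erases (∃′ A)  = ex (erase (K⁻-erases A))

  ⇝-ren : ∀ ρ {F A} → F ⇝ A → renF ρ F ⇝ renF ρ A
  ⇝-ren ρ atom = atom
  ⇝-ren ρ (conj e f) = conj (⇝-ren ρ e) (⇝-ren ρ f)
  ⇝-ren ρ (disj e f) = disj (⇝-ren ρ e) (⇝-ren ρ f)
  ⇝-ren ρ (impl e f) = impl (⇝-ren ρ e) (⇝-ren ρ f)
  ⇝-ren ρ (neg e)    = neg (⇝-ren ρ e)
  ⇝-ren ρ (all e)    = all (⇝-ren (liftR ρ) e)
  ⇝-ren ρ (ex e)     = ex (⇝-ren (liftR ρ) e)
  ⇝-ren ρ (erase e)  = erase (⇝-ren ρ e)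

  ⇝-sub : ∀ σ {F A} → F ⇝ A → subF σ F ⇝ subF σ A
  ⇝-sub σ atom = atom
  ⇝-sub σ (conj e f) = conj (⇝-sub σ e) (⇝-sub σ f)
  ⇝-sub σ (disj e f) = disj (⇝-sub σ e) (⇝-sub σ f)
  ⇝-sub σ (impl e f) = impl (⇝-sub σ e) (⇝-sub σ f)
  ⇝-sub σ (neg e)    = neg (⇝-sub σ e)
  ⇝-sub σ (all e)    = all (⇝-sub (liftS σ) e)
  ⇝-sub σ (ex e)     = ex (⇝-sub (liftS σ) e)
  ⇝-sub σ (erase e)  = erase (⇝-sub σ e)

  swapL : ∀ {Γ Δ A B} → A ∷ B ∷ Γ ⊢ᶜ Δ → B ∷ A ∷ Γ ⊢ᶜ Δ
  swapL = exch (↭.swap _ _ ↭.refl) ↭.refl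

  swapR : ∀ {Γ Δ A B} → Γ ⊢ᶜ A ∷ B ∷ Δ → Γ ⊢ᶜ B ∷ A ∷ Δ
  swapR = exch ↭.refl (↭.swap _ _ ↭.refl)

  mutual
    erasures-equivalent : ∀ {F A B Γ Δ} → F ⇝ A → F ⇝ B → A ∷ Γ ⊢ᶜ B ∷ Δ
    erasures-equivalent atom atom = ax
    erasures-equivalent (conj e₁ e₂) (conj f₁ f₂) =
      ∧L (∧R (erasures-equivalent e₁ f₁) (weakL (erasures-equivalent e₂ f₂)))
    erasures-equivalent (disj e₁ e₂) (disj f₁ f₂) =
      ∨L (∨R (erasures-equivalent e₁ f₁)) (∨R (weakR (erasures-equivalent e₂ f₂)))
    erasures-equivalent (impl e₁ e₂) (impl f₁ f₂) =
      ⇒L (swapR (⇒R (weakR (erasures-equivalent f₁ e₁))))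
         (⇒R (weakL (erasures-equivalent e₂ f₂)))
    erasures-equivalent (neg e) (neg f)   = ¬L (swapR (¬R (erasures-equivalent f e)))
    erasures-equivalent (neg e) (erase f) = ¬L (erasures-exhaustive e f)
    erasures-equivalent (erase e) (neg f) = ¬R (erasures-contradict f e)
    erasures-equivalent (erase e) (erase f) = erasures-equivalent e f
    erasures-equivalent {A = ∀′ A} (all e) (all f) =
      ∀R (∀L (var zero)
        (subst (λ X → X ∷ _ ⊢ᶜ _) (sym (wk-body-at-0 A)) (erasures-equivalent e f)))
    erasures-equivalent {B = ∃′ B} (ex e) (ex f) =
      ∃L (∃R (var zero)
        (subst (λ X → _ ⊢ᶜ X ∷ _) (sym (wk-body-at-0 B)) (erasures-equivalent e f)))

    erasures-contradict : ∀ {G A B Γ Δ} → ¬ G ⇝ A → G ⇝ B → A ∷ B ∷ Γ ⊢ᶜ Δ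
    erasures-contradict (neg e) f = ¬L (erasures-equivalent f e)
    erasures-contradict (erase e) (neg f) = swapL (¬L (erasures-equivalent e f))
    erasures-contradict (erase e) (erase f) = erasures-contradict e f

    erasures-exhaustive : ∀ {G A B Γ Δ} → ¬ G ⇝ A → G ⇝ B → Γ ⊢ᶜ A ∷ B ∷ Δ
    erasures-exhaustive (neg e) f = ¬R (erasures-equivalent e f)
    erasures-exhaustive (erase e) (neg f) = swapR (¬R (erasures-equivalent f e))
    erasures-exhaustive (erase e) (erase f) = erasures-exhaustive e f

  data Reading : List Formula → List Formula → List Formula → Set where
    []     : Reading [] [] []
    left   : ∀ {F A Γ L R} → F ⇝ A → Reading Γ L R → Reading (F ∷ Γ) (A ∷ L) R
    right  : ∀ {G B Γ L R} → G ⇝ B → Reading Γ L R → Reading (¬ G ∷ Γ) L (B ∷ R)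

  data GoalReading : Maybe Formula → List Formula → List Formula → Set where
    none  : GoalReading nothing [] []
    right : ∀ {F A} → F ⇝ A → GoalReading (just F) [] (A ∷ [])
    left  : ∀ {G B} → G ⇝ B → GoalReading (just (¬ G)) (B ∷ []) []

  reading-wk : ∀ {Γ L R} → Reading Γ L R → Reading (map wk Γ) (map wk L) (map wk R)
  reading-wk []          = []
  reading-wk (left e ρ)  = left (⇝-ren suc e) (reading-wk ρ)
  reading-wk (right e ρ) = right (⇝-ren suc e) (reading-wk ρ)

  goal-reading-wk : ∀ {C CL CR} → GoalReading C CL CR →
                    GoalReading (Maybe.map wk C) (map wk CL) (map wk CR)
  goal-reading-wk none      = none
  goal-reading-wk (right e) = right (⇝-ren suc e)
  goal-reading-wk (left e)  = left (⇝-ren suc e)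

  record PermutedReading (Γ′ L R : List Formula) : Set where
    constructor ⟨_,_,_⟩
    field
      {L′ R′}  : List Formula
      reading  : Reading Γ′ L′ R′
      left↭    : L ↭ L′
      right↭   : R ↭ R′

  reading-↭ : ∀ {Γ Γ′ L R} → Γ ↭ Γ′ → Reading Γ L R → PermutedReading Γ′ L R
  reading-↭ ↭.refl ρ = ⟨ ρ , ↭.refl , ↭.refl ⟩
  reading-↭ (↭.prep _ p) (left e ρ) with reading-↭ p ρ
  ... | ⟨ ρ′ , pl , pr ⟩ = ⟨ left e ρ′ , ↭.prep _ pl , pr ⟩
  reading-↭ (↭.prep _ p) (right e ρ) with reading-↭ p ρ
  ... | ⟨ ρ′ , pl , pr ⟩ = ⟨ right e ρ′ , pl , ↭.prep _ pr ⟩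
  reading-↭ (↭.swap _ _ p) (left e (left f ρ)) with reading-↭ p ρ
  ... | ⟨ ρ′ , pl , pr ⟩ = ⟨ left f (left e ρ′) , ↭.swap _ _ pl , pr ⟩
  reading-↭ (↭.swap _ _ p) (left e (right f ρ)) with reading-↭ p ρ
  ... | ⟨ ρ′ , pl , pr ⟩ = ⟨ right f (left e ρ′) , ↭.prep _ pl , ↭.prep _ pr ⟩
  reading-↭ (↭.swap _ _ p) (right e (left f ρ)) with reading-↭ p ρ
  ... | ⟨ ρ′ , pl , pr ⟩ = ⟨ left f (right e ρ′) , ↭.prep _ pl , ↭.prep _ pr ⟩
  reading-↭ (↭.swap _ _ p) (right e (right f ρ)) with reading-↭ p ρ
  ... | ⟨ ρ′ , pl , pr ⟩ = ⟨ right f (right e ρ′) , pl , ↭.swap _ _ pr ⟩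
  reading-↭ (↭.trans p q) ρ with reading-↭ p ρ
  ... | ⟨ ρ₁ , pl₁ , pr₁ ⟩ with reading-↭ q ρ₁
  ... | ⟨ ρ₂ , pl₂ , pr₂ ⟩ = ⟨ ρ₂ , ↭.trans pl₁ pl₂ , ↭.trans pr₁ pr₂ ⟩

  -- The decoded sequent is  L ++ CL ⊢ R ++ CR ; rules acting on the goal need
  -- the goal formulas in front, which exchange provides.  The goal reading
  -- argument only serves to fix CL and CR.
  goal-to-front : ∀ {C CL CR L R} → GoalReading C CL CR →
                  L ++ CL ⊢ᶜ R ++ CR → CL ++ L ⊢ᶜ CR ++ R
  goal-to-front {CL = CL} {CR} {L} {R} _ = exch (++-comm L CL) (++-comm R CR)

  goal-to-back : ∀ {C CL CR L R} → GoalReading C CL CR →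
                 CL ++ L ⊢ᶜ CR ++ R → L ++ CL ⊢ᶜ R ++ CR
  goal-to-back {CL = CL} {CR} {L} {R} _ = exch (++-comm CL L) (++-comm CR R)

  weaken-appended : ∀ {Γ Δ} Γ₂ Δ₂ → Γ ⊢ᶜ Δ → Γ ++ Γ₂ ⊢ᶜ Δ ++ Δ₂
  weaken-appended {Γ} {Δ} Γ₂ Δ₂ d =
    exch (++-comm Γ₂ Γ) (++-comm Δ₂ Δ) (weakenL Γ₂ (weakenR Δ₂ d))
    where
    weakenL : ∀ Γ₂ {Γ Δ} → Γ ⊢ᶜ Δ → Γ₂ ++ Γ ⊢ᶜ Δ
    weakenL []       d = d
    weakenL (_ ∷ Γ₂) d = weakL (weakenL Γ₂ d)
    weakenR : ∀ Δ₂ {Γ Δ} → Γ ⊢ᶜ Δ → Γ ⊢ᶜ Δ₂ ++ Δ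
    weakenR []       d = d
    weakenR (_ ∷ Δ₂) d = weakR (weakenR Δ₂ d)

  -- One clause per LJ rule and reading.
  -- decode-front states the same with the goal formulas moved in front, the
  -- form in which premises of right rules are needed.
  decode-front : ∀ {Γ C L R CL CR} → Γ ⊢ⁱ C → Reading Γ L R → GoalReading C CL CR →
                 CL ++ L ⊢ᶜ CR ++ R
  decode : ∀ {Γ C L R CL CR} → Γ ⊢ⁱ C → Reading Γ L R → GoalReading C CL CR →
           L ++ CL ⊢ᶜ R ++ CR
  decode ax (left e ρ)  γ@(right f) = goal-to-back γ (erasures-equivalent e f)
  decode ax (left e ρ)  γ@(left f)  = goal-to-back γ (swapL (erasures-contradict e f))
  decode ax (right e ρ) γ@(right f) = goal-to-back γ (erasures-exhaustive f e)
  decode ax (right e ρ) γ@(left f)  = goal-to-back γ (erasures-equivalent f e)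
  decode (∧L d) (left (conj e₁ e₂) ρ) γ = ∧L (decode d (left e₁ (left e₂ ρ)) γ)
  decode (∧R d₁ d₂) ρ γ@(right (conj e₁ e₂)) =
    goal-to-back γ (∧R (decode-front d₁ ρ (right e₁)) (decode-front d₂ ρ (right e₂)))
  decode (∨L d₁ d₂) (left (disj e₁ e₂) ρ) γ =
    ∨L (decode d₁ (left e₁ ρ) γ) (decode d₂ (left e₂ ρ) γ)
  decode (∨R₁ d) ρ γ@(right (disj e₁ e₂)) =
    goal-to-back γ (∨R (swapR (weakR (decode-front d ρ (right e₁)))))
  decode (∨R₂ d) ρ γ@(right (disj e₁ e₂)) =
    goal-to-back γ (∨R (weakR (decode-front d ρ (right e₂))))
  decode {CL = CL} {CR} (⇒L d₁ d₂) (left (impl e₁ e₂) ρ) γ =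
    ⇒L (weaken-appended CL CR (decode-front d₁ ρ (right e₁))) (decode d₂ (left e₂ ρ) γ)
  decode (⇒R d) ρ γ@(right (impl e₁ e₂)) =
    goal-to-back γ (⇒R (decode-front d (left e₁ ρ) (right e₂)))
  decode (¬L d) (left (neg e) ρ) none =
    goal-to-back none (¬L (decode-front d ρ (right e)))
  decode (¬L d) (left (erase e) ρ) none =
    goal-to-back none (decode-front d ρ (left e))
  decode (¬L d) (right e ρ) none =
    goal-to-back none (decode-front d ρ (right e))
  decode (¬R d) ρ γ@(right (neg e)) =
    goal-to-back γ (¬R (decode-front d (left e ρ) none))
  decode (¬R d) ρ γ@(right (erase e)) =
    goal-to-back γ (decode-front d (right e ρ) none)
  decode (¬R d) ρ γ@(left e) =
    goal-to-back γ (decode-front d (left e ρ) none)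
  decode (∀L t d) (left (all e) ρ) γ = ∀L t (decode d (left (⇝-sub (single t) e) ρ) γ)
  decode (∀R d) ρ γ@(right (all e)) =
    goal-to-back γ (∀R (decode-front d (reading-wk ρ) (right e)))
  decode {L = _ ∷ L} {R} {CL} {CR} (∃L d) (left (ex e) ρ) γ =
    ∃L (exch (↭.prep _ (↭-reflexive (sym (map-++ wk L CL))))
             (↭-reflexive (sym (map-++ wk R CR)))
             (decode d (left e (reading-wk ρ)) (goal-reading-wk γ)))
  decode (∃R t d) ρ γ@(right (ex e)) =
    goal-to-back γ (∃R t (decode-front d ρ (right (⇝-sub (single t) e))))
  decode (contrL d) (left e ρ)  γ = contrL (decode d (left e (left e ρ)) γ)
  decode (contrL d) (right e ρ) γ = contrR (decode d (right e (right e ρ)) γ)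
  decode (weakL d) (left e ρ)  γ = weakL (decode d ρ γ)
  decode (weakL d) (right e ρ) γ = weakR (decode d ρ γ)
  decode (weakR d) ρ γ@(right e) = goal-to-back γ (weakR (decode-front d ρ none))
  decode (weakR d) ρ γ@(left e)  = goal-to-back γ (weakL (decode-front d ρ none))
  decode {CL = CL} {CR} (exch p d) ρ γ with reading-↭ (↭-sym p) ρ
  ... | ⟨ ρ′ , pl , pr ⟩ =
    exch (++⁺ʳ CL (↭-sym pl)) (++⁺ʳ CR (↭-sym pr)) (decode d ρ′ γ)

  decode-front d ρ γ = goal-to-front γ (decode d ρ γ)

  translated-reading : ∀ Γ Δ → Reading (map K⁺ Γ ++ map (λ A → ¬ K⁻ A) Δ) Γ Δ
  translated-reading (A ∷ Γ) Δ       = left (K⁺-erases A) (translated-reading Γ Δ)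
  translated-reading []      (A ∷ Δ) = right (K⁻-erases A) (translated-reading [] Δ)
  translated-reading []      []      = []

theorem2 : (S : Signature) → let open FOL S in
    (Γ Δ : List Formula) (D : Formula) →
    map K⁺ Γ ++ map (λ A → ¬ K⁻ A) Δ ⊢ⁱ just (K⁻ D) →
    Γ ⊢ᶜ Δ ++ [ D ]
theorem2 S Γ Δ D d =
  subst (λ Γ′ → Γ′ ⊢ᶜ Δ ++ [ D ]) (++-identityʳ Γ)
    (decode d (translated-reading Γ Δ) (right (K⁻-erases D)))
  where open FOL S
        open Kolmogorov S
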